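{- If $\mathbf w$ is a basis isolating weight assignment for $f\in\mathbb F^k[\mathbf x]$, then $f$ has a unique least basis $B$ with respect to $\mathbf w$. In particular, for every other basis $B'$ of $f$, $\mathbf w(B)<\mathbf w(B')$.
   Context: Throughout, $\mathbb F=\mathbb Q$. $f\in\mathbb F^k[x_1,\dots,x_n]$ has coefficients in $\mathbb F^k$; a basis of $f$ is a set of monomials whose coefficients form a basis of the span $\mathrm{lrsp}(f)$ of all coefficients of $f$. A weight assignment $\mathbf w\in\mathbb Z_{\ge0}^n$ gives $\mathbf w(\mathbf x^{\mathbf e})=\sum_ie_iw_i$ and, for a set $B$ of monomials, $\mathbf w(B)=\sum_{m\in B}\mathbf w(m)$. For bases $B=\{m_1,\dots,m_\ell\}$, $B'=\{m'_1,\dots,m'_\ell\}$ listed in non-decreasing order of weight: $B<B'$ if there is $i$ with $\mathbf w(m_j)=\mathbf w(m'_j)$ for all $j<i$ and $\mathbf w(m_i)<\mathbf w(m'_i)$; $B\le B'$ if $B<B'$ or $\mathbf w(m_i)\le\mathbf w(m'_i)$ for all $i$. A least basis is a basis $B$ with $B\le B'$ for every basis $B'$. $\mathbf w$ is basis isolating for $f$ if there is a basis $B$ such that (1) the monomials of $B$ have pairwise distinct weights, and (2) for every monomial $m$ in the support of $f$ not in $B$, $\mathrm{coef}_m(f)$ lies in the span of $\{\mathrm{coef}_{m'}(f): m'\in B,\ \mathbf w(m')<\mathbf w(m)\}$. -}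

module Defs where

open import Data.Nat as ℕ using (ℕ; zero; suc; _<_; _≤_; _<?_)
open import Data.Nat.Properties using (≤-decTotalOrder)
open import Data.Nat.ListAction using (sum)
open import Data.Rational as ℚ using (ℚ; 0ℚ)
open import Data.Vec as V using (Vec; []; _∷_)
open import Data.Vec.Properties using (≡-dec)
open import Data.List as L using (List; []; _∷_; length)
open import Data.List.Membership.Propositional using (_∈_)
open import Data.List.Relation.Binary.Pointwise using (Pointwise)
open import Data.List.Relation.Binary.Permutation.Propositional using (_↭_)
open import Data.Product using (Σ; _×_; _,_; proj₁; proj₂)
open import Data.Sum using (_⊎_)
open import Relation.Binary.PropositionalEquality using (_≡_)
open import Relation.Nullary using (¬_)
open import Function.Bundles using (_⇔_)
import Data.List.Sort

-- Monomials in x₁..xₙ are exponent vectors; coefficients live in ℚ^k.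

Monomial : ℕ → Set
Monomial n = Vec ℕ n

_≟m_ : ∀ {n} (m m′ : Monomial n) → Relation.Nullary.Dec (m ≡ m′)
_≟m_ = ≡-dec ℕ._≟_

Vecℚ : ℕ → Set
Vecℚ k = Vec ℚ k

zeroV : ∀ {k} → Vecℚ k
zeroV = V.replicate _ 0ℚ

_+V_ : ∀ {k} → Vecℚ k → Vecℚ k → Vecℚ k
_+V_ = V.zipWith ℚ._+_

_·V_ : ∀ {k} → ℚ → Vecℚ k → Vecℚ k
c ·V v = V.map (c ℚ.*_) v

-- A polynomial f ∈ ℚ^k[x₁..xₙ] given as a formal finite sum of terms
-- (monomial, coefficient vector); repeated monomials are added up.
Poly : ℕ → ℕ → Set
Poly n k = List (Monomial n × Vecℚ k)

coef : ∀ {n k} → Poly n k → Monomial n → Vecℚ k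
coef f m = L.foldr _+V_ zeroV
             (L.map proj₂ (L.filter (λ t → proj₁ t ≟m m) f))

InSupport : ∀ {n k} → Poly n k → Monomial n → Set
InSupport f m = ¬ (coef f m ≡ zeroV)

lincomb : ∀ {k} (vs : List (Vecℚ k)) → Vec ℚ (length vs) → Vecℚ k
lincomb []       []       = zeroV
lincomb (v ∷ vs) (c ∷ cs) = (c ·V v) +V lincomb vs cs

InSpan : ∀ {k} → List (Vecℚ k) → Vecℚ k → Set
InSpan vs v = Σ (Vec ℚ (length vs)) λ cs → lincomb vs cs ≡ v

LinIndep : ∀ {k} → List (Vecℚ k) → Set
LinIndep vs = ∀ cs → lincomb vs cs ≡ zeroV → cs ≡ V.replicate _ 0ℚ

InLrsp : ∀ {n k} → Poly n k → Vecℚ k → Set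
InLrsp f v = InSpan (L.map (coef f) (L.map proj₁ f)) v

coefs : ∀ {n k} → Poly n k → List (Monomial n) → List (Vecℚ k)
coefs f B = L.map (coef f) B

IsBasis : ∀ {n k} → Poly n k → List (Monomial n) → Set
IsBasis f B = Unique B × LinIndep (coefs f B)
            × (∀ v → InLrsp f v ⇔ InSpan (coefs f B) v)
  where open import Data.List.Relation.Unary.Unique.Propositional using (Unique)

wt : ∀ {n} → Vec ℕ n → Monomial n → ℕ
wt w m = V.sum (V.zipWith ℕ._*_ m w)

wtSet : ∀ {n} → Vec ℕ n → List (Monomial n) → ℕ
wtSet w B = sum (L.map (wt w) B)

open Data.List.Sort ≤-decTotalOrder using (sort)

sortedWts : ∀ {n} → Vec ℕ n → List (Monomial n) → List ℕ
sortedWts w B = sort (L.map (wt w) B)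

data Lex< : List ℕ → List ℕ → Set where
  here  : ∀ {a b as bs} → a < b → Lex< (a ∷ as) (b ∷ bs)
  there : ∀ {a b as bs} → a ≡ b → Lex< as bs → Lex< (a ∷ as) (b ∷ bs)

_<[_]_ : ∀ {n} → List (Monomial n) → Vec ℕ n → List (Monomial n) → Set
B <[ w ] B′ = Lex< (sortedWts w B) (sortedWts w B′)

_≤[_]_ : ∀ {n} → List (Monomial n) → Vec ℕ n → List (Monomial n) → Set
B ≤[ w ] B′ = B <[ w ] B′ ⊎ Pointwise _≤_ (sortedWts w B) (sortedWts w B′)

IsLeastBasis : ∀ {n k} → Poly n k → Vec ℕ n → List (Monomial n) → Set
IsLeastBasis f w B = IsBasis f B × (∀ B′ → IsBasis f B′ → B ≤[ w ] B′)

BasisIsolating : ∀ {n k} → Poly n k → Vec ℕ n → Set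
BasisIsolating f w = Σ (List (Monomial _)) λ B →
    IsBasis f B
  × (∀ m m′ → m ∈ B → m′ ∈ B → wt w m ≡ wt w m′ → m ≡ m′)
  × (∀ m → InSupport f m → ¬ (m ∈ B) →
       InSpan (coefs f (L.filter (λ m′ → wt w m′ <? wt w m) B)) (coef f m))

-- equality of finite sets of monomials (represented as repetition-free lists)
_≈set_ : ∀ {n} → List (Monomial n) → List (Monomial n) → Set
B ≈set B′ = B ↭ B′

module Submission where

-- Condition (2) puts the coefficient of every support monomial of weight ≤ t in the span of the
-- coefficients of the monomials of B₀ of weight ≤ t. Comparing dimensions, every basis B has at most
-- as many monomials of weight ≤ t as B₀, for every t; for the sorted weight sequences of B₀ and B,
-- which have the same length, this says that B₀'s sequence is entrywise below B's. So B₀ is least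
-- and w(B₀) ≤ w(B). If the two sequences coincide, a monomial of B outside B₀, of weight t say,
-- would be one more independent coefficient in the span of B₀'s coefficients of weight < t;
-- hence B = B₀, and w(B₀) < w(B) for every other basis B.

open import Defs
open import Data.Nat as ℕ using (ℕ; zero; suc; _+_; _<_; _≤_; z≤n; s≤s; _≤?_; _<?_)
import Data.Nat.Properties as ℕP
open import Data.Nat.ListAction using (sum)
open import Data.Nat.ListAction.Properties using (sum-↭)
open import Data.Rational as ℚ using (ℚ; 0ℚ; 1ℚ; -_)
import Data.Rational.Properties as ℚP
open import Data.Vec as V using (Vec; []; _∷_)
open import Data.Vec.Properties
  using (zipWith-comm; zipWith-assoc; zipWith-identityˡ; zipWith-identityʳ; map-∘; map-cong; map-id)
open import Data.List as L using (List; []; _∷_; length; filter)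
import Data.List.Properties as LP
open import Data.List.Membership.Propositional using (_∈_)
open import Data.List.Membership.Propositional.Properties using (∈-map⁺; ∈-map⁻; ∈-filter⁺; ∈-filter⁻; ∈-∃++)
open import Data.List.Relation.Unary.Any using (here; there)
open import Data.List.Relation.Unary.All as All using (All; []; _∷_)
open import Data.List.Relation.Unary.Linked as Linked using (Linked)
open import Data.List.Relation.Unary.Linked.Properties using (Linked⇒All)
open import Data.List.Relation.Binary.Pointwise using (Pointwise; []; _∷_; Pointwise-≡⇒≡; antisymmetric)
open import Data.List.Relation.Binary.Sublist.Propositional using (_⊆_; []; _∷ʳ_; _∷_; ⊆-refl)
import Data.List.Relation.Binary.Sublist.Propositional.Properties as SubP
open import Data.List.Relation.Unary.Unique.Propositional using (Unique)
open import Data.List.Relation.Unary.AllPairs using (_∷_)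
open import Data.List.Relation.Binary.Permutation.Propositional
  using (_↭_; refl; prep; swap; trans; ↭-sym)
open import Data.List.Relation.Binary.Permutation.Propositional.Properties
  using (shift; All-resp-↭; ↭-length; ∈-resp-↭; filter-↭)
open import Data.List.Sort ℕP.≤-decTotalOrder using (sort-↭; sort-↗)
open import Function.Bundles using (Equivalence)
open import Data.Product using (Σ; _×_; _,_; proj₁; proj₂)
open import Data.Sum using (_⊎_; inj₁; inj₂)
open import Data.Empty using (⊥-elim)
open import Function using (_∘_)
open import Level using (0ℓ)
open import Relation.Unary using (Pred; Decidable)
open import Relation.Nullary using (¬_; yes; no)
open import Relation.Nullary.Decidable using (_⊎-dec_)
open import Relation.Binary.PropositionalEquality
  using (_≡_; _≢_; refl; cong; cong₂; sym; subst; subst₂; module ≡-Reasoning)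
  renaming (trans to ≡-trans)
open import Algebra.Bundles using (CommutativeMonoid)
open import Algebra.Properties.CommutativeSemigroup
  (CommutativeMonoid.commutativeSemigroup ℚP.+-0-commutativeMonoid) using (interchange)

open ≡-Reasoning

variable
  k : ℕ

-- Lists and counting

∈⇒↭-front : {A : Set} {x : A} {xs : List A} → x ∈ xs → Σ (List A) λ rest → xs ↭ x ∷ rest
∈⇒↭-front {x = x} x∈ with ∈-∃++ x∈
... | ys , zs , refl = ys L.++ zs , shift x ys zs

length-filter-map : {A : Set} {P : Pred ℕ 0ℓ} (P? : Decidable P) (g : A → ℕ) (xs : List A) →
                    length (filter P? (L.map g xs)) ≡ length (filter (P? ∘ g) xs)
length-filter-map P? g []       = refl
length-filter-map P? g (x ∷ xs) with P? (g x)
... | yes _ = cong suc (length-filter-map P? g xs)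
... | no  _ = length-filter-map P? g xs

length-filter-< : {A : Set} {P Q : Pred A 0ℓ} (P? : Decidable P) (Q? : Decidable Q) →
                  (∀ {x} → P x → Q x) → ∀ {y xs} → y ∈ xs → Q y → ¬ P y →
                  length (filter P? xs) < length (filter Q? xs)
length-filter-< P? Q? P⇒Q {y} {xs} y∈xs Qy ¬Py =
  ℕP.≤∧≢⇒< (SubP.length-mono-≤ filterP⊆filterQ) λ same →
    ¬Py (proj₂ (∈-filter⁻ P? {xs = xs} (subst (y ∈_) (sym (Pointwise-≡⇒≡ (SubP.to-≋ same filterP⊆filterQ)))
                                               (∈-filter⁺ Q? y∈xs Qy))))
  where
  filterP⊆filterQ : filter P? xs ⊆ filter Q? xs
  filterP⊆filterQ = SubP.filter⁺ P? Q? (λ { refl → P⇒Q }) (⊆-refl {x = xs})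

Unique∧⊆∧length≡⇒↭ : {A : Set} {xs ys : List A} → Unique xs → (∀ {x} → x ∈ xs → x ∈ ys) →
                      length xs ≡ length ys → xs ↭ ys
Unique∧⊆∧length≡⇒↭ {xs = []}     {[]}    _ _ _ = refl
Unique∧⊆∧length≡⇒↭ {xs = x ∷ xs} {ys} (x∉xs ∷ unique) xs⊆ys len with ∈⇒↭-front (xs⊆ys (here refl))
... | ys′ , ys↭ = trans (prep x (Unique∧⊆∧length≡⇒↭ unique xs⊆ys′ len′)) (↭-sym ys↭)
  where
  len′ : length xs ≡ length ys′
  len′ = ℕP.suc-injective (≡-trans len (↭-length ys↭))
  xs⊆ys′ : ∀ {z} → z ∈ xs → z ∈ ys′
  xs⊆ys′ z∈xs with ∈-resp-↭ ys↭ (xs⊆ys (there z∈xs))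
  ... | here z≡x  = ⊥-elim (All.lookup x∉xs z∈xs (sym z≡x))
  ... | there z∈ = z∈

count≤ : ℕ → List ℕ → ℕ
count≤ t xs = length (filter (_≤? t) xs)

count≤-none : ∀ {t xs} → All (t <_) xs → count≤ t xs ≡ 0
count≤-none {t} t<xs = cong length (LP.filter-none (_≤? t) (All.map ℕP.<⇒≱ t<xs))

count≤-∷ : ∀ {t x xs} → x ≤ t → count≤ t (x ∷ xs) ≡ suc (count≤ t xs)
count≤-∷ {t} x≤t = cong length (LP.filter-accept (_≤? t) x≤t)

sorted-count≤⇒pointwise-≤ : ∀ {xs ys} → Linked _≤_ xs → Linked _≤_ ys → length xs ≡ length ys →
                             (∀ t → count≤ t ys ≤ count≤ t xs) → Pointwise _≤_ xs ys
sorted-count≤⇒pointwise-≤ {[]}     {[]}     _  _  _   _     = []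
sorted-count≤⇒pointwise-≤ {a ∷ xs} {b ∷ ys} ↗xs ↗ys len count≥ =
  a≤b ∷ sorted-count≤⇒pointwise-≤ (Linked.tail ↗xs) (Linked.tail ↗ys) (ℕP.suc-injective len) tail-count≥
  where
  above : ∀ {t c zs} → t < c → Linked _≤_ (c ∷ zs) → All (t <_) (c ∷ zs)
  above t<c ↗ = All.map (ℕP.<-≤-trans t<c) (Linked⇒All ℕP.≤-trans ℕP.≤-refl ↗)
  a≤b : a ≤ b
  a≤b with a ≤? b
  ... | yes a≤b = a≤b
  ... | no  a≰b = ⊥-elim (ℕP.n≮0 (subst₂ _≤_ (count≤-∷ {b} {xs = ys} ℕP.≤-refl)
                                              (count≤-none {xs = a ∷ xs} (above (ℕP.≰⇒> a≰b) ↗xs))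
                                              (count≥ b)))
  tail-count≥ : ∀ t → count≤ t ys ≤ count≤ t xs
  tail-count≥ t with b ≤? t
  ... | no  b≰t = subst (_≤ count≤ t xs) (sym (count≤-none (All.tail (above (ℕP.≰⇒> b≰t) ↗ys)))) z≤n
  ... | yes b≤t = ℕ.s≤s⁻¹ (subst₂ _≤_ (count≤-∷ b≤t) (count≤-∷ (ℕP.≤-trans a≤b b≤t)) (count≥ t))

Pointwise-≤⇒sum≤ : ∀ {xs ys} → Pointwise _≤_ xs ys → sum xs ≤ sum ys
Pointwise-≤⇒sum≤ []       = z≤n
Pointwise-≤⇒sum≤ (p ∷ ps) = ℕP.+-mono-≤ p (Pointwise-≤⇒sum≤ ps)

Pointwise-≤∧sum≥⇒≡ : ∀ {xs ys} → Pointwise _≤_ xs ys → sum ys ≤ sum xs → xs ≡ ys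
Pointwise-≤∧sum≥⇒≡ []                                   _  = refl
Pointwise-≤∧sum≥⇒≡ {a ∷ xs} {b ∷ ys} (a≤b ∷ ps) sum≥ = cong₂ _∷_ a≡b (Pointwise-≤∧sum≥⇒≡ ps tail-sum≥)
  where
  a≡b : a ≡ b
  a≡b = ℕP.≤-antisym a≤b
          (ℕP.+-cancelʳ-≤ (sum ys) b a (ℕP.≤-trans sum≥ (ℕP.+-monoʳ-≤ a (Pointwise-≤⇒sum≤ ps))))
  tail-sum≥ : sum ys ≤ sum xs
  tail-sum≥ = ℕP.+-cancelˡ-≤ b (sum ys) (sum xs) (subst (λ z → b + sum ys ≤ z + sum xs) a≡b sum≥)

Pointwise-≤⇒¬Lex> : ∀ {xs ys} → Pointwise _≤_ xs ys → ¬ Lex< ys xs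
Pointwise-≤⇒¬Lex> (a≤b ∷ _)  (here b<a)    = ℕP.<⇒≱ b<a a≤b
Pointwise-≤⇒¬Lex> (_   ∷ ps) (there _ lex) = Pointwise-≤⇒¬Lex> ps lex

-- Linear algebra in ℚ^k

+V-comm : (u v : Vecℚ k) → u +V v ≡ v +V u
+V-comm = zipWith-comm ℚP.+-comm

+V-assoc : (u v x : Vecℚ k) → (u +V v) +V x ≡ u +V (v +V x)
+V-assoc = zipWith-assoc ℚP.+-assoc

+V-identityˡ : (v : Vecℚ k) → zeroV +V v ≡ v
+V-identityˡ = zipWith-identityˡ ℚP.+-identityˡ

+V-identityʳ : (v : Vecℚ k) → v +V zeroV ≡ v
+V-identityʳ = zipWith-identityʳ ℚP.+-identityʳ

+V-interchange : (a b c d : Vecℚ k) → (a +V b) +V (c +V d) ≡ (a +V c) +V (b +V d)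
+V-interchange []       []       []       []       = refl
+V-interchange (a ∷ as) (b ∷ bs) (c ∷ cs) (d ∷ ds) =
  cong₂ _∷_ (interchange a b c d) (+V-interchange as bs cs ds)

·V-zeroˡ : (v : Vecℚ k) → 0ℚ ·V v ≡ zeroV
·V-zeroˡ []      = refl
·V-zeroˡ (a ∷ v) = cong₂ _∷_ (ℚP.*-zeroˡ a) (·V-zeroˡ v)

·V-zeroʳ : ∀ c → c ·V zeroV {k} ≡ zeroV
·V-zeroʳ {zero}  c = refl
·V-zeroʳ {suc k} c = cong₂ _∷_ (ℚP.*-zeroʳ c) (·V-zeroʳ c)

·V-identityˡ : (v : Vecℚ k) → 1ℚ ·V v ≡ v
·V-identityˡ v = ≡-trans (map-cong ℚP.*-identityˡ v) (map-id v)

·V-assoc : ∀ a b (v : Vecℚ k) → a ·V (b ·V v) ≡ (a ℚ.* b) ·V v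
·V-assoc a b v = ≡-trans (sym (map-∘ _ _ v)) (map-cong (λ x → sym (ℚP.*-assoc a b x)) v)

·V-distribˡ : ∀ c (u v : Vecℚ k) → c ·V (u +V v) ≡ (c ·V u) +V (c ·V v)
·V-distribˡ c []      []      = refl
·V-distribˡ c (a ∷ u) (b ∷ v) = cong₂ _∷_ (ℚP.*-distribˡ-+ c a b) (·V-distribˡ c u v)

·V-distribʳ : ∀ a b (v : Vecℚ k) → (a ℚ.+ b) ·V v ≡ (a ·V v) +V (b ·V v)
·V-distribʳ a b []      = refl
·V-distribʳ a b (x ∷ v) = cong₂ _∷_ (ℚP.*-distribʳ-+ x a b) (·V-distribʳ a b v)

·V-cancelˡ : ∀ a → a ≢ 0ℚ → (v : Vecℚ k) → a ·V v ≡ zeroV → v ≡ zeroV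
·V-cancelˡ a a≢0 []      _  = refl
·V-cancelˡ a a≢0 (x ∷ v) eq = cong₂ _∷_ x≡0 (·V-cancelˡ a a≢0 v (cong V.tail eq))
  where
  instance _ = ℚ.≢-nonZero a≢0
  x≡0 : x ≡ 0ℚ
  x≡0 = begin
    x                        ≡⟨ sym (ℚP.*-identityˡ x) ⟩
    1ℚ ℚ.* x                 ≡⟨ cong (ℚ._* x) (sym (ℚP.*-inverseˡ a)) ⟩
    (ℚ.1/ a ℚ.* a) ℚ.* x     ≡⟨ ℚP.*-assoc (ℚ.1/ a) a x ⟩
    ℚ.1/ a ℚ.* (a ℚ.* x)     ≡⟨ cong (ℚ.1/ a ℚ.*_) (cong V.head eq) ⟩
    ℚ.1/ a ℚ.* 0ℚ            ≡⟨ ℚP.*-zeroʳ (ℚ.1/ a) ⟩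
    0ℚ                       ∎

lincomb-zero : (vs : List (Vecℚ k)) → lincomb vs zeroV ≡ zeroV
lincomb-zero []       = refl
lincomb-zero (v ∷ vs) = begin
  (0ℚ ·V v) +V lincomb vs zeroV  ≡⟨ cong₂ _+V_ (·V-zeroˡ v) (lincomb-zero vs) ⟩
  zeroV +V zeroV                 ≡⟨ +V-identityˡ zeroV ⟩
  zeroV                          ∎

lincomb-+ : (vs : List (Vecℚ k)) (cs ds : Vec ℚ (length vs)) →
            lincomb vs (cs +V ds) ≡ lincomb vs cs +V lincomb vs ds
lincomb-+ []       []       []       = sym (+V-identityˡ zeroV)
lincomb-+ (v ∷ vs) (c ∷ cs) (d ∷ ds) = begin
  ((c ℚ.+ d) ·V v) +V lincomb vs (cs +V ds)
    ≡⟨ cong₂ _+V_ (·V-distribʳ c d v) (lincomb-+ vs cs ds) ⟩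
  ((c ·V v) +V (d ·V v)) +V (lincomb vs cs +V lincomb vs ds)
    ≡⟨ +V-interchange _ _ _ _ ⟩
  ((c ·V v) +V lincomb vs cs) +V ((d ·V v) +V lincomb vs ds)  ∎

lincomb-· : (vs : List (Vecℚ k)) (a : ℚ) (cs : Vec ℚ (length vs)) →
            lincomb vs (a ·V cs) ≡ a ·V lincomb vs cs
lincomb-· []       a []       = sym (·V-zeroʳ a)
lincomb-· (v ∷ vs) a (c ∷ cs) = begin
  ((a ℚ.* c) ·V v) +V lincomb vs (a ·V cs)
    ≡⟨ cong₂ _+V_ (sym (·V-assoc a c v)) (lincomb-· vs a cs) ⟩
  (a ·V (c ·V v)) +V (a ·V lincomb vs cs)
    ≡⟨ sym (·V-distribˡ a _ _) ⟩
  a ·V ((c ·V v) +V lincomb vs cs)  ∎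

lincomb-zero-head : (v : Vecℚ k) (vs : List (Vecℚ k)) (c : ℚ) (cs : Vec ℚ (length vs)) →
                    c ≡ 0ℚ → lincomb (v ∷ vs) (c ∷ cs) ≡ lincomb vs cs
lincomb-zero-head v vs c cs refl = begin
  (0ℚ ·V v) +V lincomb vs cs  ≡⟨ cong (_+V lincomb vs cs) (·V-zeroˡ v) ⟩
  zeroV +V lincomb vs cs      ≡⟨ +V-identityˡ _ ⟩
  lincomb vs cs               ∎

variable
  u v : Vecℚ k
  us vs : List (Vecℚ k)

InSpan-zero : (vs : List (Vecℚ k)) → InSpan vs zeroV
InSpan-zero vs = zeroV , lincomb-zero vs

InSpan-+ : InSpan vs u → InSpan vs v → InSpan vs (u +V v)
InSpan-+ {vs = vs} (cs , p) (ds , q) = cs +V ds , ≡-trans (lincomb-+ vs cs ds) (cong₂ _+V_ p q)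

InSpan-· : ∀ a → InSpan vs v → InSpan vs (a ·V v)
InSpan-· {vs = vs} a (cs , p) = a ·V cs , ≡-trans (lincomb-· vs a cs) (cong (a ·V_) p)

∈⇒InSpan : v ∈ vs → InSpan vs v
∈⇒InSpan {v = v} {vs = v ∷ vs} (here refl) = 1ℚ ∷ zeroV , (begin
  (1ℚ ·V v) +V lincomb vs zeroV  ≡⟨ cong₂ _+V_ (·V-identityˡ v) (lincomb-zero vs) ⟩
  v +V zeroV                     ≡⟨ +V-identityʳ v ⟩
  v                              ∎)
∈⇒InSpan {vs = x ∷ vs} (there v∈) =
  let cs , p = ∈⇒InSpan v∈ in 0ℚ ∷ cs , ≡-trans (lincomb-zero-head x vs 0ℚ cs refl) p

InSpan-trans : All (InSpan us) vs → InSpan vs v → InSpan us v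
InSpan-trans {us = us} []                    ([] , refl) = InSpan-zero us
InSpan-trans {us = us} {vs = _ ∷ vs} (s ∷ ss) (c ∷ cs , refl) =
  InSpan-+ {vs = us} (InSpan-· {vs = us} c s) (InSpan-trans {us = us} {vs = vs} ss (cs , refl))

InSpan-mono : (∀ {x} → x ∈ vs → x ∈ us) → InSpan vs v → InSpan us v
InSpan-mono {vs = vs} {us = us} vs⊆us =
  InSpan-trans {us = us} {vs = vs} (All.tabulate (λ x∈ → ∈⇒InSpan (vs⊆us x∈)))

LinIndep-tail : LinIndep (v ∷ vs) → LinIndep vs
LinIndep-tail {v = v} {vs = vs} ind cs eq =
  cong V.tail (ind (0ℚ ∷ cs) (≡-trans (lincomb-zero-head v vs 0ℚ cs refl) eq))

LinIndep⇒≢zeroV : LinIndep vs → v ∈ vs → v ≢ zeroV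
LinIndep⇒≢zeroV {vs = v ∷ vs} ind (here refl) v≡0 with ind (1ℚ ∷ zeroV) (begin
  (1ℚ ·V v) +V lincomb vs zeroV  ≡⟨ cong₂ _+V_ (≡-trans (·V-identityˡ v) v≡0) (lincomb-zero vs) ⟩
  zeroV +V zeroV                 ≡⟨ +V-identityˡ zeroV ⟩
  zeroV                          ∎)
... | ()
LinIndep⇒≢zeroV ind (there v∈) = LinIndep⇒≢zeroV (LinIndep-tail ind) v∈

padCoeffs : {xs ys : List (Vecℚ k)} → xs ⊆ ys → Vec ℚ (length xs) → Vec ℚ (length ys)
padCoeffs []       []       = []
padCoeffs (y ∷ʳ p) cs       = 0ℚ ∷ padCoeffs p cs
padCoeffs (_ ∷ p)  (c ∷ cs) = c ∷ padCoeffs p cs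

lincomb-padCoeffs : {xs ys : List (Vecℚ k)} (p : xs ⊆ ys) (cs : Vec ℚ (length xs)) →
                    lincomb ys (padCoeffs p cs) ≡ lincomb xs cs
lincomb-padCoeffs []       []       = refl
lincomb-padCoeffs {ys = y ∷ ys} (y ∷ʳ p) cs =
  ≡-trans (lincomb-zero-head y ys 0ℚ (padCoeffs p cs) refl) (lincomb-padCoeffs p cs)
lincomb-padCoeffs (refl ∷ p) (c ∷ cs) = cong (_ +V_) (lincomb-padCoeffs p cs)

padCoeffs-zero : {xs ys : List (Vecℚ k)} (p : xs ⊆ ys) (cs : Vec ℚ (length xs)) →
                 padCoeffs p cs ≡ zeroV → cs ≡ zeroV
padCoeffs-zero []       []       _  = refl
padCoeffs-zero (y ∷ʳ p) cs       eq = padCoeffs-zero p cs (cong V.tail eq)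
padCoeffs-zero (_ ∷ p)  (c ∷ cs) eq = cong₂ _∷_ (cong V.head eq) (padCoeffs-zero p cs (cong V.tail eq))

LinIndep-⊆ : {xs ys : List (Vecℚ k)} → xs ⊆ ys → LinIndep ys → LinIndep xs
LinIndep-⊆ p ind cs eq = padCoeffs-zero p cs (ind (padCoeffs p cs) (≡-trans (lincomb-padCoeffs p cs) eq))

permuteCoeffs : {xs ys : List (Vecℚ k)} → xs ↭ ys → Vec ℚ (length xs) → Vec ℚ (length ys)
permuteCoeffs refl         cs           = cs
permuteCoeffs (prep _ p)   (c ∷ cs)     = c ∷ permuteCoeffs p cs
permuteCoeffs (swap _ _ p) (c ∷ d ∷ cs) = d ∷ c ∷ permuteCoeffs p cs
permuteCoeffs (trans p q)  cs           = permuteCoeffs q (permuteCoeffs p cs)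

lincomb-permuteCoeffs : {xs ys : List (Vecℚ k)} (p : xs ↭ ys) (cs : Vec ℚ (length xs)) →
                        lincomb ys (permuteCoeffs p cs) ≡ lincomb xs cs
lincomb-permuteCoeffs refl       cs       = refl
lincomb-permuteCoeffs (prep _ p) (c ∷ cs) = cong (_ +V_) (lincomb-permuteCoeffs p cs)
lincomb-permuteCoeffs {xs = x ∷ y ∷ xs} {ys = y ∷ x ∷ ys} (swap x y p) (c ∷ d ∷ cs) = begin
  (d ·V y) +V ((c ·V x) +V lincomb ys (permuteCoeffs p cs))
    ≡⟨ cong (λ z → (d ·V y) +V ((c ·V x) +V z)) (lincomb-permuteCoeffs p cs) ⟩
  (d ·V y) +V ((c ·V x) +V lincomb xs cs)  ≡⟨ sym (+V-assoc _ _ _) ⟩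
  ((d ·V y) +V (c ·V x)) +V lincomb xs cs  ≡⟨ cong (_+V lincomb xs cs) (+V-comm _ _) ⟩
  ((c ·V x) +V (d ·V y)) +V lincomb xs cs  ≡⟨ +V-assoc _ _ _ ⟩
  (c ·V x) +V ((d ·V y) +V lincomb xs cs)  ∎
lincomb-permuteCoeffs (trans p q) cs =
  ≡-trans (lincomb-permuteCoeffs q (permuteCoeffs p cs)) (lincomb-permuteCoeffs p cs)

permuteCoeffs-zero : {xs ys : List (Vecℚ k)} (p : xs ↭ ys) (cs : Vec ℚ (length xs)) →
                     permuteCoeffs p cs ≡ zeroV → cs ≡ zeroV
permuteCoeffs-zero refl       cs       eq = eq
permuteCoeffs-zero (prep _ p) (c ∷ cs) eq =
  cong₂ _∷_ (cong V.head eq) (permuteCoeffs-zero p cs (cong V.tail eq))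
permuteCoeffs-zero (swap _ _ p) (c ∷ d ∷ cs) eq =
  cong₂ _∷_ (cong (V.head ∘ V.tail) eq)
    (cong₂ _∷_ (cong V.head eq) (permuteCoeffs-zero p cs (cong (V.tail ∘ V.tail) eq)))
permuteCoeffs-zero (trans p q) cs eq = permuteCoeffs-zero p cs (permuteCoeffs-zero q (permuteCoeffs p cs) eq)

LinIndep-↭ : {xs ys : List (Vecℚ k)} → xs ↭ ys → LinIndep ys → LinIndep xs
LinIndep-↭ p ind cs eq =
  permuteCoeffs-zero p cs (ind (permuteCoeffs p cs) (≡-trans (lincomb-permuteCoeffs p cs) eq))

record Pivot (u : Vecℚ k) (us vs : List (Vecℚ k)) : Set where
  constructor pivot
  field
    {v₀}    : Vecℚ k
    v₀∈vs   : v₀ ∈ vs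
    scale   : ℚ
    scale≢0 : scale ≢ 0ℚ
    coeffs  : Vec ℚ (length us)
    v₀≡     : (scale ·V u) +V lincomb us coeffs ≡ v₀

findPivot : (u : Vecℚ k) (us : List (Vecℚ k)) →
            All (InSpan (u ∷ us)) vs → All (InSpan us) vs ⊎ Pivot u us vs
findPivot u us [] = inj₁ []
findPivot {vs = w ∷ vs} u us ((b ∷ cs , w≡) ∷ ws) with b ℚ.≟ 0ℚ | findPivot u us ws
... | no b≢0   | _                                = inj₂ (pivot (here refl) b b≢0 cs w≡)
... | yes _    | inj₂ (pivot v₀∈ a a≢0 cs₀ v₀≡)   = inj₂ (pivot (there v₀∈) a a≢0 cs₀ v₀≡)
... | yes b≡0  | inj₁ ws′                          =
  inj₁ ((cs , ≡-trans (sym (lincomb-zero-head u us b cs b≡0)) w≡) ∷ ws′)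

cancel-u : ∀ a b (u X Y : Vecℚ k) →
           (a ·V ((b ·V u) +V X)) +V ((- b) ·V ((a ·V u) +V Y)) ≡ (a ·V X) +V ((- b) ·V Y)
cancel-u a b u X Y = begin
  (a ·V ((b ·V u) +V X)) +V ((- b) ·V ((a ·V u) +V Y))
    ≡⟨ cong₂ _+V_ (·V-distribˡ a _ _) (·V-distribˡ (- b) _ _) ⟩
  ((a ·V (b ·V u)) +V (a ·V X)) +V (((- b) ·V (a ·V u)) +V ((- b) ·V Y))
    ≡⟨ +V-interchange _ _ _ _ ⟩
  ((a ·V (b ·V u)) +V ((- b) ·V (a ·V u))) +V ((a ·V X) +V ((- b) ·V Y))
    ≡⟨ cong (_+V _) u-part≡0 ⟩
  zeroV +V ((a ·V X) +V ((- b) ·V Y))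
    ≡⟨ +V-identityˡ _ ⟩
  (a ·V X) +V ((- b) ·V Y)  ∎
  where
  ab-ba≡0 : a ℚ.* b ℚ.+ (- b) ℚ.* a ≡ 0ℚ
  ab-ba≡0 = begin
    a ℚ.* b ℚ.+ (- b) ℚ.* a    ≡⟨ cong (a ℚ.* b ℚ.+_) (sym (ℚP.neg-distribˡ-* b a)) ⟩
    a ℚ.* b ℚ.+ - (b ℚ.* a)    ≡⟨ cong (λ z → a ℚ.* b ℚ.+ - z) (ℚP.*-comm b a) ⟩
    a ℚ.* b ℚ.+ - (a ℚ.* b)    ≡⟨ ℚP.+-inverseʳ (a ℚ.* b) ⟩
    0ℚ                         ∎
  u-part≡0 : (a ·V (b ·V u)) +V ((- b) ·V (a ·V u)) ≡ zeroV
  u-part≡0 = begin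
    (a ·V (b ·V u)) +V ((- b) ·V (a ·V u))   ≡⟨ cong₂ _+V_ (·V-assoc a b u) (·V-assoc (- b) a u) ⟩
    ((a ℚ.* b) ·V u) +V (((- b) ℚ.* a) ·V u) ≡⟨ sym (·V-distribʳ (a ℚ.* b) ((- b) ℚ.* a) u) ⟩
    (a ℚ.* b ℚ.+ (- b) ℚ.* a) ·V u           ≡⟨ cong (_·V u) ab-ba≡0 ⟩
    0ℚ ·V u                                  ≡⟨ ·V-zeroˡ u ⟩
    zeroV                                    ∎

module Elimination (u : Vecℚ k) (us : List (Vecℚ k)) (a : ℚ) (v₀ : Vecℚ k) where

  eliminate : All (InSpan (u ∷ us)) vs → List (Vecℚ k)
  eliminate []                                = []
  eliminate {vs = w ∷ _} ((b ∷ _ , _) ∷ ws) = (a ·V w) +V ((- b) ·V v₀) ∷ eliminate ws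

  length-eliminate : (ws : All (InSpan (u ∷ us)) vs) → length (eliminate ws) ≡ length vs
  length-eliminate []                 = refl
  length-eliminate ((_ ∷ _ , _) ∷ ws) = cong suc (length-eliminate ws)

  reindex : (ws : All (InSpan (u ∷ us)) vs) → Vec ℚ (length (eliminate ws)) → Vec ℚ (length vs)
  reindex []                 []       = []
  reindex ((_ ∷ _ , _) ∷ ws) (d ∷ ds) = d ∷ reindex ws ds

  reindex-zero : (ws : All (InSpan (u ∷ us)) vs) (ds : Vec ℚ (length (eliminate ws))) →
                 reindex ws ds ≡ zeroV → ds ≡ zeroV
  reindex-zero []                 []       _  = refl
  reindex-zero ((_ ∷ _ , _) ∷ ws) (d ∷ ds) eq =
    cong₂ _∷_ (cong V.head eq) (reindex-zero ws ds (cong V.tail eq))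

  v₀-coeff : (ws : All (InSpan (u ∷ us)) vs) → Vec ℚ (length (eliminate ws)) → ℚ
  v₀-coeff []                 []       = 0ℚ
  v₀-coeff ((b ∷ _ , _) ∷ ws) (d ∷ ds) = d ℚ.* (- b) ℚ.+ v₀-coeff ws ds

  lincomb-eliminate : (ws : All (InSpan (u ∷ us)) vs) (ds : Vec ℚ (length (eliminate ws))) →
    lincomb (eliminate ws) ds ≡ (a ·V lincomb vs (reindex ws ds)) +V (v₀-coeff ws ds ·V v₀)
  lincomb-eliminate [] [] = begin
    zeroV                          ≡⟨ sym (+V-identityˡ zeroV) ⟩
    zeroV +V zeroV                 ≡⟨ cong₂ _+V_ (sym (·V-zeroʳ a)) (sym (·V-zeroˡ v₀)) ⟩
    (a ·V zeroV) +V (0ℚ ·V v₀)     ∎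
  lincomb-eliminate {vs = w ∷ vs} ((b ∷ _ , _) ∷ ws) (d ∷ ds) = begin
    (d ·V ((a ·V w) +V ((- b) ·V v₀))) +V lincomb (eliminate ws) ds
      ≡⟨ cong₂ _+V_ (·V-distribˡ d _ _) (lincomb-eliminate ws ds) ⟩
    ((d ·V (a ·V w)) +V (d ·V ((- b) ·V v₀))) +V ((a ·V S) +V (c ·V v₀))
      ≡⟨ +V-interchange _ _ _ _ ⟩
    ((d ·V (a ·V w)) +V (a ·V S)) +V ((d ·V ((- b) ·V v₀)) +V (c ·V v₀))
      ≡⟨ cong₂ _+V_ (cong (_+V (a ·V S)) da≡ad) (cong (_+V (c ·V v₀)) (·V-assoc d (- b) v₀)) ⟩
    ((a ·V (d ·V w)) +V (a ·V S)) +V (((d ℚ.* (- b)) ·V v₀) +V (c ·V v₀))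
      ≡⟨ cong₂ _+V_ (sym (·V-distribˡ a _ _)) (sym (·V-distribʳ (d ℚ.* (- b)) c v₀)) ⟩
    (a ·V ((d ·V w) +V S)) +V ((d ℚ.* (- b) ℚ.+ c) ·V v₀)  ∎
    where
    S = lincomb vs (reindex ws ds)
    c = v₀-coeff ws ds
    da≡ad : d ·V (a ·V w) ≡ a ·V (d ·V w)
    da≡ad = begin
      d ·V (a ·V w)      ≡⟨ ·V-assoc d a w ⟩
      (d ℚ.* a) ·V w     ≡⟨ cong (_·V w) (ℚP.*-comm d a) ⟩
      (a ℚ.* d) ·V w     ≡⟨ sym (·V-assoc a d w) ⟩
      a ·V (d ·V w)      ∎

  module _ (a≢0 : a ≢ 0ℚ) (cs₀ : Vec ℚ (length us)) (v₀≡ : (a ·V u) +V lincomb us cs₀ ≡ v₀) where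

    eliminate-InSpan : (ws : All (InSpan (u ∷ us)) vs) → All (InSpan us) (eliminate ws)
    eliminate-InSpan [] = []
    eliminate-InSpan {vs = w ∷ _} ((b ∷ cs , w≡) ∷ ws) =
      subst (InSpan us) eq
        (InSpan-+ {vs = us} (InSpan-· {vs = us} a (cs , refl)) (InSpan-· {vs = us} (- b) (cs₀ , refl)))
        ∷ eliminate-InSpan ws
      where
      eq : (a ·V lincomb us cs) +V ((- b) ·V lincomb us cs₀) ≡ (a ·V w) +V ((- b) ·V v₀)
      eq = begin
        (a ·V lincomb us cs) +V ((- b) ·V lincomb us cs₀)
          ≡⟨ sym (cancel-u a b u _ _) ⟩
        (a ·V ((b ·V u) +V lincomb us cs)) +V ((- b) ·V ((a ·V u) +V lincomb us cs₀))
          ≡⟨ cong₂ (λ x y → (a ·V x) +V ((- b) ·V y)) w≡ v₀≡ ⟩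
        (a ·V w) +V ((- b) ·V v₀)  ∎

    eliminate-LinIndep : (ws : All (InSpan (u ∷ us)) vs) → LinIndep (v₀ ∷ vs) → LinIndep (eliminate ws)
    eliminate-LinIndep {vs = vs} ws ind ds eq =
      reindex-zero ws ds (·V-cancelˡ a a≢0 _ (cong V.tail (ind (c ∷ (a ·V reindex ws ds)) combination≡0)))
      where
      c = v₀-coeff ws ds
      combination≡0 : (c ·V v₀) +V lincomb vs (a ·V reindex ws ds) ≡ zeroV
      combination≡0 = begin
        (c ·V v₀) +V lincomb vs (a ·V reindex ws ds)   ≡⟨ cong ((c ·V v₀) +V_) (lincomb-· vs a _) ⟩
        (c ·V v₀) +V (a ·V lincomb vs (reindex ws ds)) ≡⟨ +V-comm _ _ ⟩
        (a ·V lincomb vs (reindex ws ds)) +V (c ·V v₀) ≡⟨ sym (lincomb-eliminate ws ds) ⟩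
        lincomb (eliminate ws) ds                      ≡⟨ eq ⟩
        zeroV                                          ∎

-- If some v ∈ vs has a nonzero u-coordinate, use it as a pivot to eliminate u from the others;
-- the results are independent and lie in the span of us.
LinIndep⇒length≤ : (us vs : List (Vecℚ k)) → LinIndep vs → All (InSpan us) vs → length vs ≤ length us
LinIndep⇒length≤ []       []       _   _                = z≤n
LinIndep⇒length≤ []       (v ∷ vs) ind (([] , v≡0) ∷ _) = ⊥-elim (LinIndep⇒≢zeroV ind (here refl) (sym v≡0))
LinIndep⇒length≤ (u ∷ us) vs       ind spans with findPivot u us spans
... | inj₁ spans′ = ℕP.m≤n⇒m≤1+n (LinIndep⇒length≤ us vs ind spans′)
... | inj₂ (pivot v₀∈ a a≢0 cs₀ v₀≡) with ∈⇒↭-front v₀∈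
...   | rest , vs↭ with All-resp-↭ vs↭ spans
...     | _ ∷ spans-rest =
  subst (_≤ suc (length us)) (sym (↭-length vs↭))
    (s≤s (subst (_≤ length us) (length-eliminate spans-rest)
      (LinIndep⇒length≤ us (eliminate spans-rest)
        (eliminate-LinIndep a≢0 cs₀ v₀≡ spans-rest (LinIndep-↭ (↭-sym vs↭) ind))
        (eliminate-InSpan a≢0 cs₀ v₀≡ spans-rest))))
  where open Elimination u us a _

-- Bases and weights

module _ {n : ℕ} (f : Poly n k) where

  basis⊆support : ∀ {B m} → IsBasis f B → m ∈ B → InSupport f m
  basis⊆support (_ , indep , _) m∈B = LinIndep⇒≢zeroV indep (∈-map⁺ (coef f) m∈B)

  basis-spans : ∀ {B B′ m} → IsBasis f B → IsBasis f B′ → m ∈ B′ → InSpan (coefs f B) (coef f m)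
  basis-spans (_ , _ , B-spans) (_ , _ , B′-spans) m∈B′ =
    Equivalence.to (B-spans _) (Equivalence.from (B′-spans _) (∈⇒InSpan (∈-map⁺ (coef f) m∈B′)))

  coefs-LinIndep⇒length≤ : ∀ {xs ys} → LinIndep (coefs f xs) →
                           (∀ {m} → m ∈ xs → InSpan (coefs f ys) (coef f m)) → length xs ≤ length ys
  coefs-LinIndep⇒length≤ {xs} {ys} indep spans =
    subst₂ _≤_ (LP.length-map (coef f) xs) (LP.length-map (coef f) ys)
      (LinIndep⇒length≤ (coefs f ys) (coefs f xs) indep (All.tabulate inSpan))
    where
    inSpan : ∀ {v} → v ∈ coefs f xs → InSpan (coefs f ys) v
    inSpan v∈ with ∈-map⁻ (coef f) v∈
    ... | m , m∈xs , refl = spans m∈xs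

  basis-filter-length≤ : ∀ {B C} {P : Pred (Monomial n) 0ℓ} (P? : Decidable P) → IsBasis f B →
                         (∀ {m} → m ∈ B → P m → InSpan (coefs f C) (coef f m)) →
                         length (filter P? B) ≤ length C
  basis-filter-length≤ {B} {C} P? (_ , indep , _) spans =
    coefs-LinIndep⇒length≤ {ys = C} (LinIndep-⊆ (SubP.map⁺ (coef f) (SubP.filter-⊆ P? B)) indep)
      (λ m∈ → let m∈B , Pm = ∈-filter⁻ P? {xs = B} m∈ in spans m∈B Pm)

  bases-length≡ : ∀ {B B′} → IsBasis f B → IsBasis f B′ → length B ≡ length B′
  bases-length≡ {B} {B′} B-basis B′-basis =
    ℕP.≤-antisym (coefs-LinIndep⇒length≤ {ys = B′} (proj₁ (proj₂ B-basis)) (basis-spans B′-basis B-basis))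
                 (coefs-LinIndep⇒length≤ {ys = B} (proj₁ (proj₂ B′-basis)) (basis-spans B-basis B′-basis))

coefs-filter-mono : ∀ {n} (f : Poly n k) {P Q : Pred (Monomial n) 0ℓ} (P? : Decidable P) (Q? : Decidable Q) →
                    (∀ {m} → P m → Q m) → ∀ {B v} → v ∈ coefs f (filter P? B) → v ∈ coefs f (filter Q? B)
coefs-filter-mono f P? Q? P⇒Q {B} =
  SubP.Any-resp-⊆ (SubP.map⁺ (coef f) (SubP.filter⁺ P? Q? (λ { refl → P⇒Q }) (⊆-refl {x = B})))

length-filter-sortedWts : ∀ {n} (w : Vec ℕ n) {P : Pred ℕ 0ℓ} (P? : Decidable P) (B : List (Monomial n)) →
                          length (filter P? (sortedWts w B)) ≡ length (filter (P? ∘ wt w) B)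
length-filter-sortedWts w P? B =
  ≡-trans (↭-length (filter-↭ P? (sort-↭ (L.map (wt w) B)))) (length-filter-map P? (wt w) B)

length-sortedWts : ∀ {n} (w : Vec ℕ n) (B : List (Monomial n)) → length (sortedWts w B) ≡ length B
length-sortedWts w B = ≡-trans (↭-length (sort-↭ (L.map (wt w) B))) (LP.length-map (wt w) B)

wtSet≡sum-sortedWts : ∀ {n} (w : Vec ℕ n) (B : List (Monomial n)) → wtSet w B ≡ sum (sortedWts w B)
wtSet≡sum-sortedWts w B = sym (sum-↭ (sort-↭ (L.map (wt w) B)))

module IsolatingBasis {n} (f : Poly n k) (w : Vec ℕ n) (B₀ : List (Monomial n)) (B₀-basis : IsBasis f B₀)
  (isolating : ∀ m → InSupport f m → ¬ (m ∈ B₀) →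
               InSpan (coefs f (filter (λ m′ → wt w m′ <? wt w m) B₀)) (coef f m)) where

  open import Data.List.Membership.DecPropositional (_≟m_ {n}) using (_∈?_)

  coef-InSpan-lowerPart : {Q : Pred ℕ 0ℓ} (Q? : Decidable Q) → (∀ {i j} → i < j → Q j → Q i) →
                          ∀ {m} → InSupport f m → Q (wt w m) →
                          InSpan (coefs f (filter (Q? ∘ wt w) B₀)) (coef f m)
  coef-InSpan-lowerPart Q? downward {m} m∈supp Qm with m ∈? B₀
  ... | yes m∈B₀ = ∈⇒InSpan (∈-map⁺ (coef f) (∈-filter⁺ (Q? ∘ wt w) m∈B₀ Qm))
  ... | no  m∉B₀ =
    InSpan-mono {vs = coefs f (filter (λ m′ → wt w m′ <? wt w m) B₀)} {us = coefs f (filter (Q? ∘ wt w) B₀)}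
      (coefs-filter-mono f (λ m′ → wt w m′ <? wt w m) (Q? ∘ wt w) (λ lt → downward lt Qm) {B₀})
      (isolating m m∈supp m∉B₀)

  sortedWts-least : ∀ {B} → IsBasis f B → Pointwise _≤_ (sortedWts w B₀) (sortedWts w B)
  sortedWts-least {B} B-basis =
    sorted-count≤⇒pointwise-≤ (sort-↗ _) (sort-↗ _)
      (≡-trans (length-sortedWts w B₀)
        (≡-trans (bases-length≡ f B₀-basis B-basis) (sym (length-sortedWts w B))))
      count≥
    where
    count≥ : ∀ t → count≤ t (sortedWts w B) ≤ count≤ t (sortedWts w B₀)
    count≥ t =
      subst₂ _≤_ (sym (length-filter-sortedWts w (_≤? t) B)) (sym (length-filter-sortedWts w (_≤? t) B₀))
      (basis-filter-length≤ f {C = filter (λ m → wt w m ≤? t) B₀} (λ m → wt w m ≤? t) B-basis λ m∈B m≤t →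
        coef-InSpan-lowerPart (_≤? t) (λ i<j j≤t → ℕP.<⇒≤ (ℕP.<-≤-trans i<j j≤t))
          (basis⊆support f B-basis m∈B) m≤t)

  sortedWts≡⇒↭ : ∀ {B} → IsBasis f B → sortedWts w B₀ ≡ sortedWts w B → B₀ ↭ B
  sortedWts≡⇒↭ {B} B-basis sorted≡ =
    ↭-sym (Unique∧⊆∧length≡⇒↭ (proj₁ B-basis) B⊆B₀ (sym (bases-length≡ f B₀-basis B-basis)))
    where
    below : ℕ → List (Monomial n) → ℕ
    below t C = length (filter (λ m → wt w m <? t) C)
    below≡ : ∀ t → below t B₀ ≡ below t B
    below≡ t = ≡-trans (sym (length-filter-sortedWts w (_<? t) B₀))
                 (≡-trans (cong (length ∘ filter (_<? t)) sorted≡) (length-filter-sortedWts w (_<? t) B))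
    B⊆B₀ : ∀ {m′} → m′ ∈ B → m′ ∈ B₀
    B⊆B₀ {m′} m′∈B with m′ ∈? B₀
    ... | yes m′∈B₀ = m′∈B₀
    ... | no  m′∉B₀ = ⊥-elim (ℕP.<⇒≱ more (ℕP.≤-trans fewer (ℕP.≤-reflexive (below≡ t))))
      where
      t = wt w m′
      Q? : Decidable (λ m → wt w m < t ⊎ m ≡ m′)
      Q? m = (wt w m <? t) ⊎-dec (m ≟m m′)
      more : below t B < length (filter Q? B)
      more = length-filter-< (λ m → wt w m <? t) Q? inj₁ m′∈B (inj₂ refl) (ℕP.n≮n t)
      fewer : length (filter Q? B) ≤ below t B₀
      fewer = basis-filter-length≤ f {C = filter (λ m → wt w m <? t) B₀} Q? B-basis λ where
        m∈B (inj₁ m<t) → coef-InSpan-lowerPart (_<? t) ℕP.<-trans (basis⊆support f B-basis m∈B) m<t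
        m∈B (inj₂ refl) → isolating m′ (basis⊆support f B-basis m∈B) m′∉B₀

  wtSet-least : ∀ {B} → IsBasis f B → ¬ (B₀ ≈set B) → wtSet w B₀ < wtSet w B
  wtSet-least {B} B-basis B₀≉B =
    subst₂ _<_ (sym (wtSet≡sum-sortedWts w B₀)) (sym (wtSet≡sum-sortedWts w B))
      (ℕP.≤∧≢⇒< (Pointwise-≤⇒sum≤ (sortedWts-least B-basis)) λ sum≡ →
        B₀≉B (sortedWts≡⇒↭ B-basis
               (Pointwise-≤∧sum≥⇒≡ (sortedWts-least B-basis) (ℕP.≤-reflexive (sym sum≡)))))

  B₀-least : IsLeastBasis f w B₀
  B₀-least = B₀-basis , λ _ B-basis → inj₂ (sortedWts-least B-basis)

  least-unique : ∀ {B} → IsLeastBasis f w B → B₀ ≈set B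
  least-unique (B-basis , B-least) with B-least B₀ B₀-basis
  ... | inj₁ B<B₀ = ⊥-elim (Pointwise-≤⇒¬Lex> (sortedWts-least B-basis) B<B₀)
  ... | inj₂ B≤B₀ = sortedWts≡⇒↭ B-basis
                      (Pointwise-≡⇒≡ (antisymmetric ℕP.≤-antisym (sortedWts-least B-basis) B≤B₀))

lemma24 : ∀ {n k} (f : Poly n k) (w : Vec ℕ n) → BasisIsolating f w →
    Σ (List (Monomial n)) λ B → IsLeastBasis f w B
    × (∀ B′ → IsLeastBasis f w B′ → B ≈set B′)
    × (∀ B′ → IsBasis f B′ → ¬ (B ≈set B′) → wtSet w B < wtSet w B′)
lemma24 f w (B₀ , B₀-basis , _ , isolating) = B₀ , B₀-least , (λ _ → least-unique) , (λ _ → wtSet-least)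
  where open IsolatingBasis f w B₀ B₀-basis isolating
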